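{- Let $G=(V_0\uplus V_1,E,p)$ be a bipartite parity game with $|V_1|=k$ and $p$ distinct priorities, and suppose $G$ is reduced in the following sense: (a) there are no distinct $u,v\in V_0$ with $N^+_G(v)\subseteq N^+_G(u)$, $p_1(v)\ge p_1(u)$ and some $w$ with $(w,u)\in E$ and $(w,v)\in E$; (b) there are no distinct $u,v\in V_0$ with $N^+_G(u)=N^+_G(v)$ and $p(u)=p(v)$; (c) no node of $G$ has an empty in-neighbourhood. Then $|V_0|\le 2^k\cdot\min\{k,p\}$.
   Context: A parity game $G=(V_0\uplus V_1,E,p)$ consists of a finite directed graph on $V=V_0\uplus V_1$ (no parallel edges) in which every node has at least one outgoing edge, and a priority function $p:V\to\mathbb{N}_0$; $V_0$ is owned by player $0$ (even), $V_1$ by player $1$ (odd). $G$ is bipartite if $E\subseteq(V_0\times V_1)\cup(V_1\times V_0)$. $N^+_G(v)$ denotes the out-neighbours of $v$. For a node $v$, $p_1(v)=p(v)$ if $p(v)$ is odd and $p_1(v)=-p(v)$ if $p(v)$ is even. -}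

module Defs where

open import Data.Nat using (ℕ; zero; suc)
open import Data.Bool using (Bool; true; false; if_then_else_)
open import Data.Integer using (ℤ; +_; -_)
open import Data.Fin using (Fin)
open import Data.Sum using (_⊎_; inj₁; inj₂)
open import Data.Product using (Σ; ∃; _×_)
open import Data.List using (List; length)
open import Data.List.Membership.Propositional using (_∈_)
open import Data.List.Relation.Unary.Unique.Propositional using (Unique)
open import Relation.Binary.PropositionalEquality using (_≡_; _≢_)

-- The node set is V = V₀ ⊎ V₁ (inj₁ = owned by player 0, inj₂ = owned by player 1).
record ParityGame : Set where
  field
    n₀ n₁ : ℕ
    E     : Fin n₀ ⊎ Fin n₁ → Fin n₀ ⊎ Fin n₁ → Bool
    prio  : Fin n₀ ⊎ Fin n₁ → ℕ
    total : ∀ v → ∃ λ w → E v w ≡ true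

  Node : Set
  Node = Fin n₀ ⊎ Fin n₁

open ParityGame public

owner : (G : ParityGame) → Node G → Bool
owner G (inj₁ _) = false
owner G (inj₂ _) = true

Bipartite : ParityGame → Set
Bipartite G = ∀ u v → E G u v ≡ true → owner G u ≢ owner G v

OutSub : (G : ParityGame) → Node G → Node G → Set
OutSub G v u = ∀ w → E G v w ≡ true → E G u w ≡ true

OutEq : (G : ParityGame) → Node G → Node G → Set
OutEq G u v = OutSub G u v × OutSub G v u

isEven : ℕ → Bool
isEven zero = true
isEven (suc n) = if isEven n then false else true

p₁ : ℕ → ℤ
p₁ n = if isEven n then - (+ n) else + n

NumPriorities : ParityGame → ℕ → Set
NumPriorities G d =
  Σ (List ℕ) λ l → Unique l × length l ≡ d
                 × (∀ v → prio G v ∈ l)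
                 × (∀ x → x ∈ l → ∃ λ v → prio G v ≡ x)

CondA : ParityGame → Set
CondA G = ∀ (u v : Fin (n₀ G)) → u ≢ v
  → OutSub G (inj₁ v) (inj₁ u)
  → p₁ (prio G (inj₁ v)) Data.Integer.≥ p₁ (prio G (inj₁ u))
  → ∀ w → E G w (inj₁ u) ≡ true → E G w (inj₁ v) ≡ true → Data.Empty.⊥
  where import Data.Empty

CondB : ParityGame → Set
CondB G = ∀ (u v : Fin (n₀ G)) → u ≢ v
  → OutEq G (inj₁ u) (inj₁ v)
  → prio G (inj₁ u) ≡ prio G (inj₁ v) → Data.Empty.⊥
  where import Data.Empty

CondC : ParityGame → Set
CondC G = ∀ v → ∃ λ w → E G w v ≡ true

Reduced : ParityGame → Set
Reduced G = CondA G × CondB G × CondC G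

module Submission where

open import Defs
open import Data.Nat using (ℕ; _≤_; _*_; _^_; _⊓_)
open import Data.Nat.Properties using (⊓-glb; *-distribˡ-⊓)
open import Data.Bool using (Bool; true)
open import Data.Fin using (Fin; _≟_; funToFin; finToFun; combine)
open import Data.Fin.Properties
  using (2↔Bool; finToFun-funToFin; combine-injective; injective⇒≤)
import Data.Integer.Properties as ℤ
open import Data.Sum using (inj₁; inj₂)
open import Data.Product using (∃; _,_; proj₁)
open import Data.Empty using (⊥-elim)
open import Data.List using (length)
open import Data.List.Relation.Unary.Any using (index)
open import Data.List.Membership.Setoid.Properties using (index-injective)
open import Function using (_∘_; Inverse)
open import Relation.Nullary using (yes; no)
open import Relation.Binary.PropositionalEquality
  using (_≡_; _≗_; refl; sym; trans; cong; subst; setoid; module ≡-Reasoning)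

-- Since G is bipartite, a player-0 node u is determined up to its label by
-- N⁺(u) ⊆ V₁, one of 2^k subsets. Two nodes with equal out-neighbourhoods cannot
-- share an in-neighbour (which lies in V₁): comparing their p₁-values, (a) fails
-- in one direction. Nor can they share a priority, by (b). So u ↦ (N⁺(u), an
-- in-neighbour of u) and u ↦ (N⁺(u), p(u)) are injective, and |V₀| is bounded
-- by both 2^k · k and 2^k · p.

open Inverse 2↔Bool using (to; from; strictlyInverseˡ)

subsetCode : ∀ {k} → (Fin k → Bool) → Fin (2 ^ k)
subsetCode s = funToFin (from ∘ s)

subsetCode-injective : ∀ {k} {s t : Fin k → Bool} → subsetCode s ≡ subsetCode t → s ≗ t
subsetCode-injective {s = s} {t} eq j = begin
  s j                            ≡⟨ strictlyInverseˡ (s j) ⟨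
  to (from (s j))                ≡⟨ cong to (finToFun-funToFin _ j) ⟨
  to (finToFun (subsetCode s) j) ≡⟨ cong (λ c → to (finToFun c j)) eq ⟩
  to (finToFun (subsetCode t) j) ≡⟨ cong to (finToFun-funToFin _ j) ⟩
  to (from (t j))                ≡⟨ strictlyInverseˡ (t j) ⟩
  t j                            ∎
  where open ≡-Reasoning

≤-2^*-of-subset×label-injective : ∀ {n k m} (s : Fin n → Fin k → Bool) (ℓ : Fin n → Fin m)
  → (∀ {u v} → s u ≗ s v → ℓ u ≡ ℓ v → u ≡ v) → n ≤ 2 ^ k * m
≤-2^*-of-subset×label-injective s ℓ inj =
  injective⇒≤ {f = λ u → combine (subsetCode (s u)) (ℓ u)} λ eq →
    let sᵤ≡sᵥ , ℓᵤ≡ℓᵥ = combine-injective _ _ _ _ eq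
    in inj (subsetCode-injective sᵤ≡sᵥ) ℓᵤ≡ℓᵥ

≤-*-⊓ : ∀ {n} c a b → n ≤ c * a → n ≤ c * b → n ≤ c * (a ⊓ b)
≤-*-⊓ {n} c a b p q = subst (n ≤_) (sym (*-distribˡ-⊓ c a b)) (⊓-glb p q)

module _ {G : ParityGame} (bip : Bipartite G) where

  N⁺ : Fin (n₀ G) → Fin (n₁ G) → Bool
  N⁺ u j = E G (inj₁ u) (inj₂ j)

  N⁺-≗⇒OutSub : ∀ {u v} → N⁺ u ≗ N⁺ v → OutSub G (inj₁ u) (inj₁ v)
  N⁺-≗⇒OutSub _  (inj₁ _) e = ⊥-elim (bip _ _ e refl)
  N⁺-≗⇒OutSub eq (inj₂ j) e = trans (sym (eq j)) e

  inNeighbour : CondC G → (v : Fin (n₀ G)) → ∃ λ j → E G (inj₂ j) (inj₁ v) ≡ true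
  inNeighbour cc v with cc (inj₁ v)
  ... | inj₁ _ , e = ⊥-elim (bip _ _ e refl)
  ... | inj₂ j , e = j , e

  CondA⇒inNeighbour-separates : CondA G → (cc : CondC G) → ∀ {u v} → N⁺ u ≗ N⁺ v
    → proj₁ (inNeighbour cc u) ≡ proj₁ (inNeighbour cc v) → u ≡ v
  CondA⇒inNeighbour-separates ca cc {u} {v} eq same with u ≟ v | inNeighbour cc u | inNeighbour cc v
  ... | yes u≡v | _ | _ = u≡v
  CondA⇒inNeighbour-separates ca cc {u} {v} eq refl | no u≢v | j , eᵤ | .j , eᵥ
    with ℤ.≤-total (p₁ (prio G (inj₁ u))) (p₁ (prio G (inj₁ v)))
  ... | inj₁ pᵤ≤pᵥ = ⊥-elim (ca u v u≢v (N⁺-≗⇒OutSub (sym ∘ eq)) pᵤ≤pᵥ (inj₂ j) eᵤ eᵥ)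
  ... | inj₂ pᵥ≤pᵤ = ⊥-elim (ca v u (u≢v ∘ sym) (N⁺-≗⇒OutSub eq) pᵥ≤pᵤ (inj₂ j) eᵥ eᵤ)

  CondB⇒priority-separates : CondB G → ∀ {u v} → N⁺ u ≗ N⁺ v
    → prio G (inj₁ u) ≡ prio G (inj₁ v) → u ≡ v
  CondB⇒priority-separates cb {u} {v} eq same with u ≟ v
  ... | yes u≡v = u≡v
  ... | no u≢v = ⊥-elim (cb u v u≢v (N⁺-≗⇒OutSub eq , N⁺-≗⇒OutSub (sym ∘ eq)) same)

lemma12 : (G : ParityGame) (k d : ℕ)
    → Bipartite G
    → n₁ G ≡ k
    → NumPriorities G d
    → Reduced G
    → n₀ G ≤ 2 ^ k * (k ⊓ d)
lemma12 G .(n₁ G) .(length l) bip refl (l , _ , refl , prio∈l , _) (ca , cb , cc) =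
  ≤-*-⊓ (2 ^ n₁ G) (n₁ G) (length l) byInNeighbour byPriority
  where
  byInNeighbour : n₀ G ≤ 2 ^ n₁ G * n₁ G
  byInNeighbour = ≤-2^*-of-subset×label-injective (N⁺ bip) (proj₁ ∘ inNeighbour bip cc)
    (CondA⇒inNeighbour-separates bip ca cc)

  byPriority : n₀ G ≤ 2 ^ n₁ G * length l
  byPriority = ≤-2^*-of-subset×label-injective (N⁺ bip) (index ∘ prio∈l ∘ inj₁)
    λ eq same → CondB⇒priority-separates bip cb eq (index-injective (setoid ℕ) _ _ same)
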